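{- Let $\alpha\colon L\rightharpoonup R$ be a rule and $g\colon R\to H$ a match, and let $g\Rightarrow_{\alpha^\dagger} f$ be a derivation (with comatch $f\colon L\to G$ and some corule $\beta^\dagger\colon H\rightharpoonup G$). Then $g$ is derivable by $\alpha$ if and only if this derivation is reversible, i.e. if and only if there is a derivation $f\Rightarrow_\alpha g$ with corule $\beta$.
   Context: A directed multigraph $G$ consists of finite sets $V_G$, $E_G$ and maps $s_G,t_G\colon E_G\to V_G$; morphisms are pairs of maps on nodes and edges commuting with sources and targets. A match is a morphism injective on nodes and edges. A rule $\alpha\colon L\rightharpoonup R$ is a span $L\xleftarrow{\alpha_1}K\xrightarrow{\alpha_2}R$ of matches (a partial morphism); its reverse is $\alpha^\dagger:=(\alpha_2,\alpha_1)\colon R\rightharpoonup L$. Final pullback complement (FPBC) of $X\xrightarrow{f_1}Y\xrightarrow{f_2}Z$: a pair $X\xrightarrow{g_1}W\xrightarrow{g_2}Z$ making a pullback square with $g_2\circ g_1=f_2\circ f_1$, such that for every pullback square $P\xrightarrow{f_1'}Y\xrightarrow{f_2}Z\xleftarrow{g_2'}Q\xleftarrow{g_1'}P$ and $p\colon P\to X$ with $f_1\circ p=f_1'$ there is a unique $u\colon Q\to W$ with $g_2\circ u=g_2'$, $u\circ g_1'=g_1\circ p$. A derivation of a comatch $g\colon R\to H$ from a match $f\colon L\to G$ by a rule $\alpha=(\alpha_1\colon K\to L,\alpha_2\colon K\to R)$ consists of a match $h\colon K\to D$ and morphisms $\beta_1\colon D\to G$, $\beta_2\colon D\to H$ such that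 $K\xrightarrow{h}D\xrightarrow{\beta_1}G$ is an FPBC of $K\xrightarrow{\alpha_1}L\xrightarrow{f}G$, the square $\alpha_2,h,g,\beta_2$ is a pushout of graphs, $g$ is a match and the corule $\beta=(\beta_1,\beta_2)$ is a rule. Notation $f\Rightarrow_\alpha g$. For every match $f$ and rule $\alpha$ with common domain such a derivation exists and is unique up to isomorphism. A match $g\colon R\to H$ is derivable by $\alpha$ if there exists a match $f$ with $f\Rightarrow_\alpha g$. A derivation $f\Rightarrow_\alpha g$ with corule $\beta$ is reversible if $g\Rightarrow_{\alpha^\dagger} f$ with corule $\beta^\dagger$. -}

module Defs where

open import Data.Nat using (ℕ)
open import Data.Fin using (Fin)
open import Data.Product using (Σ; Σ-syntax; _×_)
open import Relation.Binary.PropositionalEquality using (_≡_; trans; cong)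
open import Function.Definitions using (Injective)

record Graph : Set where
  field
    nV  : ℕ
    nE  : ℕ
    src : Fin nE → Fin nV
    tgt : Fin nE → Fin nV
open Graph

record Hom (G H : Graph) : Set where
  field
    vmap : Fin (nV G) → Fin (nV H)
    emap : Fin (nE G) → Fin (nE H)
    src-pres : ∀ e → vmap (src G e) ≡ src H (emap e)
    tgt-pres : ∀ e → vmap (tgt G e) ≡ tgt H (emap e)
open Hom

infixr 9 _∘ₕ_
_∘ₕ_ : ∀ {A B C} → Hom B C → Hom A B → Hom A C
g ∘ₕ f = record
  { vmap = λ x → vmap g (vmap f x)
  ; emap = λ e → emap g (emap f e)
  ; src-pres = λ e → trans (cong (vmap g) (src-pres f e)) (src-pres g (emap f e))
  ; tgt-pres = λ e → trans (cong (vmap g) (tgt-pres f e)) (tgt-pres g (emap f e))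
  }

infix 4 _≈ₕ_
_≈ₕ_ : ∀ {A B} → Hom A B → Hom A B → Set
f ≈ₕ g = (∀ x → vmap f x ≡ vmap g x) × (∀ e → emap f e ≡ emap g e)

IsMatch : ∀ {A B} → Hom A B → Set
IsMatch f = Injective _≡_ _≡_ (vmap f) × Injective _≡_ _≡_ (emap f)

IsPullback : ∀ {P X Y Z} (p1 : Hom P X) (p2 : Hom P Y) (q1 : Hom X Z) (q2 : Hom Y Z) → Set
IsPullback {P} {X} {Y} {Z} p1 p2 q1 q2 =
  (q1 ∘ₕ p1 ≈ₕ q2 ∘ₕ p2) ×
  (∀ (Q : Graph) (a : Hom Q X) (b : Hom Q Y) → q1 ∘ₕ a ≈ₕ q2 ∘ₕ b →
     Σ[ u ∈ Hom Q P ] ((p1 ∘ₕ u ≈ₕ a) × (p2 ∘ₕ u ≈ₕ b) ×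
       (∀ (u' : Hom Q P) → p1 ∘ₕ u' ≈ₕ a → p2 ∘ₕ u' ≈ₕ b → u' ≈ₕ u)))

IsPushout : ∀ {K A B Q} (i1 : Hom K A) (i2 : Hom K B) (j1 : Hom A Q) (j2 : Hom B Q) → Set
IsPushout {K} {A} {B} {Q} i1 i2 j1 j2 =
  (j1 ∘ₕ i1 ≈ₕ j2 ∘ₕ i2) ×
  (∀ (T : Graph) (a : Hom A T) (b : Hom B T) → a ∘ₕ i1 ≈ₕ b ∘ₕ i2 →
     Σ[ u ∈ Hom Q T ] ((u ∘ₕ j1 ≈ₕ a) × (u ∘ₕ j2 ≈ₕ b) ×
       (∀ (u' : Hom Q T) → u' ∘ₕ j1 ≈ₕ a → u' ∘ₕ j2 ≈ₕ b → u' ≈ₕ u)))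

IsFPBC : ∀ {X Y Z W} (f1 : Hom X Y) (f2 : Hom Y Z) (g1 : Hom X W) (g2 : Hom W Z) → Set
IsFPBC {X} {Y} {Z} {W} f1 f2 g1 g2 =
  IsPullback f1 g1 f2 g2 ×
  (∀ (P Q : Graph) (f1' : Hom P Y) (g1' : Hom P Q) (g2' : Hom Q Z) →
     IsPullback f1' g1' f2 g2' →
     (p : Hom P X) → f1 ∘ₕ p ≈ₕ f1' →
     Σ[ u ∈ Hom Q W ] ((g2 ∘ₕ u ≈ₕ g2') × (u ∘ₕ g1' ≈ₕ g1 ∘ₕ p) ×
       (∀ (u' : Hom Q W) → g2 ∘ₕ u' ≈ₕ g2' → u' ∘ₕ g1' ≈ₕ g1 ∘ₕ p → u' ≈ₕ u)))

-- Rule α : L ⇀ R, a span L ←α1− K −α2→ R of matches.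
record Rule (L R : Graph) : Set where
  field
    K : Graph
    α1 : Hom K L
    α2 : Hom K R
    α1-match : IsMatch α1
    α2-match : IsMatch α2

_† : ∀ {L R} → Rule L R → Rule R L
α † = record
  { K = Rule.K α ; α1 = Rule.α2 α ; α2 = Rule.α1 α
  ; α1-match = Rule.α2-match α ; α2-match = Rule.α1-match α }

-- f ⇒_α g with data h : K → D and corule β = (β1 : D → G, β2 : D → H).
IsDerivation : ∀ {L R G H D} (α : Rule L R) (f : Hom L G) (g : Hom R H)
  (h : Hom (Rule.K α) D) (β1 : Hom D G) (β2 : Hom D H) → Set
IsDerivation α f g h β1 β2 =
  IsMatch f × IsMatch h ×
  IsFPBC (Rule.α1 α) f h β1 ×
  IsPushout (Rule.α2 α) h g β2 ×
  IsMatch g × IsMatch β1 × IsMatch β2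

Derivable : ∀ {L R H} (α : Rule L R) (g : Hom R H) → Set
Derivable {L} {R} {H} α g =
  Σ[ G ∈ Graph ] Σ[ f ∈ Hom L G ] Σ[ D ∈ Graph ]
  Σ[ h ∈ Hom (Rule.K α) D ] Σ[ β1 ∈ Hom D G ] Σ[ β2 ∈ Hom D H ]
    IsDerivation α f g h β1 β2

-- In graphs, a pushout square in which two opposite sides are matches is both a pullback and a
-- final pullback complement; this turns the pushout square (α1, h, f, β1) of the reverse
-- derivation into the FPBC required of the forward one.  For the other square: if g is
-- derivable by α, the forward derivation provides a pushout complement K → D' → H of α2 and g
-- by matches.  Being a pullback, it maps into the final complement D; conversely every element
-- of D lands in the image of D', because H is covered by R and D' while the elements of R hit
-- from D come from K.  So D is a retract of D' over H, and the pushout property transfers.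
module Submission where

open import Defs
open import Data.Nat using (ℕ; _*_)
open import Data.Fin using (Fin; zero; suc; _≟_; combine; quotient; remainder)
open import Data.Fin.Properties using (any?; remQuot-combine)
open import Data.Product using (Σ; Σ-syntax; _×_; _,_; proj₁; proj₂)
open import Data.Sum using (_⊎_; inj₁; inj₂)
open import Data.Empty using (⊥-elim)
open import Function.Bundles using (_⇔_; mk⇔)
open import Level using (0ℓ)
open import Relation.Binary.Bundles using (Setoid)
open import Relation.Nullary using (Dec; yes; no)
open import Relation.Nullary.Decidable using (_⊎-dec_)
open import Relation.Binary.PropositionalEquality
import Relation.Binary.Reasoning.Setoid as SetoidReasoning
open Graph
open Hom

idₕ : ∀ {A} → Hom A A
idₕ = record { vmap = λ x → x ; emap = λ e → e ; src-pres = λ _ → refl ; tgt-pres = λ _ → refl }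

≈ₕ-refl : ∀ {A B} (f : Hom A B) → f ≈ₕ f
≈ₕ-refl f = (λ _ → refl) , (λ _ → refl)

≈ₕ-sym : ∀ {A B} (f g : Hom A B) → f ≈ₕ g → g ≈ₕ f
≈ₕ-sym f g (v , e) = (λ x → sym (v x)) , (λ x → sym (e x))

≈ₕ-trans : ∀ {A B} (f g k : Hom A B) → f ≈ₕ g → g ≈ₕ k → f ≈ₕ k
≈ₕ-trans f g k (v , e) (v' , e') = (λ x → trans (v x) (v' x)) , (λ x → trans (e x) (e' x))

Hom-setoid : Graph → Graph → Setoid 0ℓ 0ℓ
Hom-setoid A B = record
  { Carrier = Hom A B
  ; _≈_ = _≈ₕ_
  ; isEquivalence = record
    { refl = λ {f} → ≈ₕ-refl f
    ; sym = λ {f} {g} → ≈ₕ-sym f g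
    ; trans = λ {f} {g} {k} → ≈ₕ-trans f g k
    }
  }

∘ₕ-congˡ : ∀ {A B C} (u : Hom B C) (f g : Hom A B) → f ≈ₕ g → u ∘ₕ f ≈ₕ u ∘ₕ g
∘ₕ-congˡ u f g (v , e) = (λ x → cong (vmap u) (v x)) , (λ x → cong (emap u) (e x))

∘ₕ-congʳ : ∀ {A B C} (f g : Hom B C) → f ≈ₕ g → (w : Hom A B) → f ∘ₕ w ≈ₕ g ∘ₕ w
∘ₕ-congʳ f g (v , e) w = (λ x → v (vmap w x)) , (λ x → e (emap w x))

match-cancelˡ : ∀ {A B C} (m : Hom B C) → IsMatch m → (u v : Hom A B) → m ∘ₕ u ≈ₕ m ∘ₕ v → u ≈ₕ v
match-cancelˡ m (injV , injE) u v (mv , me) = (λ x → injV (mv x)) , (λ x → injE (me x))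

ImV : ∀ {A B} → Hom A B → Fin (nV B) → Set
ImV f y = Σ _ λ x → vmap f x ≡ y

ImE : ∀ {A B} → Hom A B → Fin (nE B) → Set
ImE f y = Σ _ λ x → emap f x ≡ y

ImV? : ∀ {A B} (f : Hom A B) y → Dec (ImV f y)
ImV? f y = any? (λ x → vmap f x ≟ y)

ImE? : ∀ {A B} (f : Hom A B) y → Dec (ImE f y)
ImE? f y = any? (λ x → emap f x ≟ y)

infix 4 _⊆Im_
record _⊆Im_ {A B C} (f : Hom A C) (m : Hom B C) : Set where
  constructor mk⊆Im
  field
    preimageᵛ : ∀ x → ImV m (vmap f x)
    preimageᵉ : ∀ e → ImE m (emap f e)

module _ {A B C : Graph} {m : Hom B C} (mm : IsMatch m) {f : Hom A C} (f⊆m : f ⊆Im m) where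
  open _⊆Im_ f⊆m

  factor : Hom A B
  factor = record
    { vmap = λ x → proj₁ (preimageᵛ x)
    ; emap = λ e → proj₁ (preimageᵉ e)
    ; src-pres = λ e → proj₁ mm (trans (proj₂ (preimageᵛ (src A e)))
        (trans (src-pres f e) (trans (cong (src C) (sym (proj₂ (preimageᵉ e)))) (sym (src-pres m _)))))
    ; tgt-pres = λ e → proj₁ mm (trans (proj₂ (preimageᵛ (tgt A e)))
        (trans (tgt-pres f e) (trans (cong (tgt C) (sym (proj₂ (preimageᵉ e)))) (sym (tgt-pres m _)))))
    }

  factor-commutes : m ∘ₕ factor ≈ₕ f
  factor-commutes = (λ x → proj₂ (preimageᵛ x)) , (λ e → proj₂ (preimageᵉ e))

  factor-unique : ∀ (u : Hom A B) → m ∘ₕ u ≈ₕ f → u ≈ₕ factor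
  factor-unique u mu≈f = match-cancelˡ m mm u factor (begin
    m ∘ₕ u      ≈⟨ mu≈f ⟩
    f           ≈⟨ factor-commutes ⟨
    m ∘ₕ factor ∎)
    where open SetoidReasoning (Hom-setoid A C)

indicator : ∀ {P : Set} → Dec P → Fin 2
indicator (yes _) = zero
indicator (no _) = suc zero

indicator-yes : ∀ {P : Set} (d : Dec P) → P → indicator d ≡ zero
indicator-yes (yes _) _ = refl
indicator-yes (no ¬p) p = ⊥-elim (¬p p)

indicator≡zero⇒ : ∀ {P : Set} (d : Dec P) → indicator d ≡ zero → P
indicator≡zero⇒ (yes p) _ = p

-- Maps into Complete n (resp. Bouquet n) are exactly the n-colourings of vertices (resp. edges);
-- they serve as test objects for the universal property of pushouts.

Complete : ℕ → Graph
Complete n = record { nV = n ; nE = n * n ; src = quotient {n} n ; tgt = remainder {n} n }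

Bouquet : ℕ → Graph
Bouquet n = record { nV = 1 ; nE = n ; src = λ _ → zero ; tgt = λ _ → zero }

colourᵛ : ∀ {n} (A : Graph) → (Fin (nV A) → Fin n) → Hom A (Complete n)
colourᵛ {n} A c = record
  { vmap = c
  ; emap = λ e → combine (c (src A e)) (c (tgt A e))
  ; src-pres = λ e → sym (cong proj₁ (remQuot-combine {n} {n} (c (src A e)) (c (tgt A e))))
  ; tgt-pres = λ e → sym (cong proj₂ (remQuot-combine {n} {n} (c (src A e)) (c (tgt A e))))
  }

colourᵉ : ∀ {n} (A : Graph) → (Fin (nE A) → Fin n) → Hom A (Bouquet n)
colourᵉ A c = record { vmap = λ _ → zero ; emap = c ; src-pres = λ _ → refl ; tgt-pres = λ _ → refl }

colourᵛ-∘ : ∀ {n A B C} (f : Hom A B) (g : Hom A C) (c : Fin (nV B) → Fin n) (c' : Fin (nV C) → Fin n) →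
            (∀ x → c (vmap f x) ≡ c' (vmap g x)) → colourᵛ B c ∘ₕ f ≈ₕ colourᵛ C c' ∘ₕ g
colourᵛ-∘ {A = A} f g c c' cf≡c'g = cf≡c'g , λ e → cong₂ combine
  (trans (cong c (sym (src-pres f e))) (trans (cf≡c'g (src A e)) (cong c' (src-pres g e))))
  (trans (cong c (sym (tgt-pres f e))) (trans (cf≡c'g (tgt A e)) (cong c' (tgt-pres g e))))

colourᵉ-∘ : ∀ {n A B C} (f : Hom A B) (g : Hom A C) (c : Fin (nE B) → Fin n) (c' : Fin (nE C) → Fin n) →
            (∀ e → c (emap f e) ≡ c' (emap g e)) → colourᵉ B c ∘ₕ f ≈ₕ colourᵉ C c' ∘ₕ g
colourᵉ-∘ f g c c' cf≡c'g = (λ _ → refl) , cf≡c'g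

Point : Graph
Point = record { nV = 1 ; nE = 0 ; src = λ () ; tgt = λ () }

Arrow : Graph
Arrow = record { nV = 2 ; nE = 1 ; src = λ _ → zero ; tgt = λ _ → suc zero }

pointAt : ∀ {X} → Fin (nV X) → Hom Point X
pointAt x = record { vmap = λ _ → x ; emap = λ () ; src-pres = λ () ; tgt-pres = λ () }

arrowAt : ∀ {X} → Fin (nE X) → Hom Arrow X
arrowAt {X} e = record
  { vmap = λ { zero → src X e ; (suc zero) → tgt X e }
  ; emap = λ _ → e
  ; src-pres = λ { zero → refl }
  ; tgt-pres = λ { zero → refl }
  }

module Pullback {P X Y Z} {p1 : Hom P X} {p2 : Hom P Y} {q1 : Hom X Z} {q2 : Hom Y Z}
                (pb : IsPullback p1 p2 q1 q2) where

  pairᵛ : ∀ {x y} → vmap q1 x ≡ vmap q2 y → Σ _ λ z → (vmap p1 z ≡ x) × (vmap p2 z ≡ y)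
  pairᵛ {x} {y} q1x≡q2y =
    let u , (p1u≈ , _) , (p2u≈ , _) , _ =
          proj₂ pb Point (pointAt x) (pointAt y) ((λ _ → q1x≡q2y) , λ ())
    in vmap u zero , p1u≈ zero , p2u≈ zero

  pairᵉ : ∀ {x y} → emap q1 x ≡ emap q2 y → Σ _ λ z → (emap p1 z ≡ x) × (emap p2 z ≡ y)
  pairᵉ {x} {y} q1x≡q2y =
    let u , (_ , p1u≈) , (_ , p2u≈) , _ =
          proj₂ pb Arrow (arrowAt x) (arrowAt y) (endpoints , λ { zero → q1x≡q2y })
    in emap u zero , p1u≈ zero , p2u≈ zero
    where
    endpoints : ∀ v → vmap q1 (vmap (arrowAt x) v) ≡ vmap q2 (vmap (arrowAt y) v)
    endpoints zero = trans (src-pres q1 x) (trans (cong (src Z) q1x≡q2y) (sym (src-pres q2 y)))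
    endpoints (suc zero) = trans (tgt-pres q1 x) (trans (cong (tgt Z) q1x≡q2y) (sym (tgt-pres q2 y)))

module Pushout {K A B Q} {i1 : Hom K A} {i2 : Hom K B} {j1 : Hom A Q} {j2 : Hom B Q}
               (po : IsPushout i1 i2 j1 j2) where

  jointly-epic : ∀ {T} (u v : Hom Q T) → u ∘ₕ j1 ≈ₕ v ∘ₕ j1 → u ∘ₕ j2 ≈ₕ v ∘ₕ j2 → u ≈ₕ v
  jointly-epic {T} u v uj1≈vj1 uj2≈vj2 =
    let w , _ , _ , unique = proj₂ po T (v ∘ₕ j1) (v ∘ₕ j2) (∘ₕ-congˡ v (j1 ∘ₕ i1) (j2 ∘ₕ i2) (proj₁ po))
        open SetoidReasoning (Hom-setoid Q T)
    in begin
      u ≈⟨ unique u uj1≈vj1 uj2≈vj2 ⟩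
      w ≈⟨ unique v (≈ₕ-refl (v ∘ₕ j1)) (≈ₕ-refl (v ∘ₕ j2)) ⟨
      v ∎

  jointly-surjectiveᵛ : ∀ y → ImV j1 y ⊎ ImV j2 y
  jointly-surjectiveᵛ y = indicator≡zero⇒ (covered? y) (proj₁ uncovered-coloured-zero y)
    where
    covered? : ∀ y → Dec (ImV j1 y ⊎ ImV j2 y)
    covered? y = ImV? j1 y ⊎-dec ImV? j2 y
    c : Fin (nV Q) → Fin 2
    c y = indicator (covered? y)
    uncovered-coloured-zero : colourᵛ Q c ≈ₕ colourᵛ Q (λ _ → zero)
    uncovered-coloured-zero = jointly-epic (colourᵛ Q c) (colourᵛ Q (λ _ → zero))
      (colourᵛ-∘ j1 j1 c (λ _ → zero) (λ a → indicator-yes (covered? _) (inj₁ (a , refl))))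
      (colourᵛ-∘ j2 j2 c (λ _ → zero) (λ b → indicator-yes (covered? _) (inj₂ (b , refl))))

  jointly-surjectiveᵉ : ∀ y → ImE j1 y ⊎ ImE j2 y
  jointly-surjectiveᵉ y = indicator≡zero⇒ (covered? y) (proj₂ uncovered-coloured-zero y)
    where
    covered? : ∀ y → Dec (ImE j1 y ⊎ ImE j2 y)
    covered? y = ImE? j1 y ⊎-dec ImE? j2 y
    c : Fin (nE Q) → Fin 2
    c y = indicator (covered? y)
    uncovered-coloured-zero : colourᵉ Q c ≈ₕ colourᵉ Q (λ _ → zero)
    uncovered-coloured-zero = jointly-epic (colourᵉ Q c) (colourᵉ Q (λ _ → zero))
      (colourᵉ-∘ j1 j1 c (λ _ → zero) (λ a → indicator-yes (covered? _) (inj₁ (a , refl))))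
      (colourᵉ-∘ j2 j2 c (λ _ → zero) (λ b → indicator-yes (covered? _) (inj₂ (b , refl))))

  -- Colour A by membership in the image of i1 and B uniformly; the induced colouring of Q
  -- sees that j1 r = j2 d forces r into that image.
  overlapᵛ : IsMatch j2 → ∀ {r d} → vmap j1 r ≡ vmap j2 d →
             Σ _ λ k → (vmap i1 k ≡ r) × (vmap i2 k ≡ d)
  overlapᵛ (injV , _) {r} {d} j1r≡j2d =
    let u , (uj1≈ , _) , (uj2≈ , _) , _ = proj₂ po (Complete 2) (colourᵛ A c) (colourᵛ B (λ _ → zero))
          (colourᵛ-∘ i1 i2 c (λ _ → zero) (λ k → indicator-yes (ImV? i1 _) (k , refl)))
        k , i1k≡r = indicator≡zero⇒ (ImV? i1 r)
          (trans (sym (uj1≈ r)) (trans (cong (vmap u) j1r≡j2d) (uj2≈ d)))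
        open ≡-Reasoning
    in k , i1k≡r , injV (begin
      vmap j2 (vmap i2 k) ≡⟨ proj₁ (proj₁ po) k ⟨
      vmap j1 (vmap i1 k) ≡⟨ cong (vmap j1) i1k≡r ⟩
      vmap j1 r           ≡⟨ j1r≡j2d ⟩
      vmap j2 d           ∎)
    where
    c : Fin (nV A) → Fin 2
    c a = indicator (ImV? i1 a)

  overlapᵉ : IsMatch j2 → ∀ {r d} → emap j1 r ≡ emap j2 d →
             Σ _ λ k → (emap i1 k ≡ r) × (emap i2 k ≡ d)
  overlapᵉ (_ , injE) {r} {d} j1r≡j2d =
    let u , (_ , uj1≈) , (_ , uj2≈) , _ = proj₂ po (Bouquet 2) (colourᵉ A c) (colourᵉ B (λ _ → zero))
          (colourᵉ-∘ i1 i2 c (λ _ → zero) (λ k → indicator-yes (ImE? i1 _) (k , refl)))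
        k , i1k≡r = indicator≡zero⇒ (ImE? i1 r)
          (trans (sym (uj1≈ r)) (trans (cong (emap u) j1r≡j2d) (uj2≈ d)))
        open ≡-Reasoning
    in k , i1k≡r , injE (begin
      emap j2 (emap i2 k) ≡⟨ proj₂ (proj₁ po) k ⟨
      emap j1 (emap i1 k) ≡⟨ cong (emap j1) i1k≡r ⟩
      emap j1 r           ≡⟨ j1r≡j2d ⟩
      emap j2 d           ∎)
    where
    c : Fin (nE A) → Fin 2
    c a = indicator (ImE? i1 a)

  pullback-leg⊆Im : ∀ {P Q'} (f1 : Hom P A) (g1 : Hom P Q') (g2 : Hom Q' Q) → IsPullback f1 g1 j1 g2 →
                    (p : Hom P K) → i1 ∘ₕ p ≈ₕ f1 → g2 ⊆Im j2
  pullback-leg⊆Im f1 g1 g2 pb p (i1p≡f1ᵛ , i1p≡f1ᵉ) = mk⊆Im vertices edges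
    where
    open ≡-Reasoning
    module PB = Pullback {p1 = f1} {p2 = g1} {q1 = j1} {q2 = g2} pb

    vertices : ∀ q → ImV j2 (vmap g2 q)
    vertices q with jointly-surjectiveᵛ (vmap g2 q)
    ... | inj₂ hit = hit
    ... | inj₁ (a , j1a≡g2q) with PB.pairᵛ j1a≡g2q
    ... | z , f1z≡a , _ = vmap i2 (vmap p z) , (begin
          vmap j2 (vmap i2 (vmap p z)) ≡⟨ proj₁ (proj₁ po) (vmap p z) ⟨
          vmap j1 (vmap i1 (vmap p z)) ≡⟨ cong (vmap j1) (trans (i1p≡f1ᵛ z) f1z≡a) ⟩
          vmap j1 a                    ≡⟨ j1a≡g2q ⟩
          vmap g2 q                    ∎)

    edges : ∀ q → ImE j2 (emap g2 q)
    edges q with jointly-surjectiveᵉ (emap g2 q)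
    ... | inj₂ hit = hit
    ... | inj₁ (a , j1a≡g2q) with PB.pairᵉ j1a≡g2q
    ... | z , f1z≡a , _ = emap i2 (emap p z) , (begin
          emap j2 (emap i2 (emap p z)) ≡⟨ proj₂ (proj₁ po) (emap p z) ⟨
          emap j1 (emap i1 (emap p z)) ≡⟨ cong (emap j1) (trans (i1p≡f1ᵉ z) f1z≡a) ⟩
          emap j1 a                    ≡⟨ j1a≡g2q ⟩
          emap g2 q                    ∎)

pushout⇒pullback : ∀ {K A B Q} (i1 : Hom K A) (i2 : Hom K B) (j1 : Hom A Q) (j2 : Hom B Q) →
                   IsPushout i1 i2 j1 j2 → IsMatch i1 → IsMatch j2 → IsPullback i1 i2 j1 j2
pushout⇒pullback {K} {A} {B} {Q} i1 i2 j1 j2 po mi1 mj2 = proj₁ po , mediate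
  where
  mediate : ∀ T (a : Hom T A) (b : Hom T B) → j1 ∘ₕ a ≈ₕ j2 ∘ₕ b →
            Σ[ u ∈ Hom T K ] ((i1 ∘ₕ u ≈ₕ a) × (i2 ∘ₕ u ≈ₕ b) ×
              (∀ u' → i1 ∘ₕ u' ≈ₕ a → i2 ∘ₕ u' ≈ₕ b → u' ≈ₕ u))
  mediate T a b (ja≡jbᵛ , ja≡jbᵉ) =
    factor mi1 a⊆i1 , factor-commutes mi1 a⊆i1 , i2u≈b , λ u' i1u'≈a _ → factor-unique mi1 a⊆i1 u' i1u'≈a
    where
    module PO = Pushout {i1 = i1} {i2 = i2} {j1 = j1} {j2 = j2} po
    overᵛ = λ x → PO.overlapᵛ mj2 (ja≡jbᵛ x)
    overᵉ = λ e → PO.overlapᵉ mj2 (ja≡jbᵉ e)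
    a⊆i1 : a ⊆Im i1
    a⊆i1 = mk⊆Im (λ x → proj₁ (overᵛ x) , proj₁ (proj₂ (overᵛ x)))
                 (λ e → proj₁ (overᵉ e) , proj₁ (proj₂ (overᵉ e)))
    i2u≈b : i2 ∘ₕ factor mi1 a⊆i1 ≈ₕ b
    i2u≈b = (λ x → proj₂ (proj₂ (overᵛ x))) , (λ e → proj₂ (proj₂ (overᵉ e)))

pushout⇒FPBC : ∀ {K A B Q} (i1 : Hom K A) (i2 : Hom K B) (j1 : Hom A Q) (j2 : Hom B Q) →
               IsPushout i1 i2 j1 j2 → IsMatch i1 → IsMatch j2 → IsFPBC i1 j1 i2 j2
pushout⇒FPBC {K} {A} {B} {Q} i1 i2 j1 j2 po mi1 mj2 = pushout⇒pullback i1 i2 j1 j2 po mi1 mj2 , final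
  where
  final : ∀ P Q' (f1 : Hom P A) (g1 : Hom P Q') (g2 : Hom Q' Q) → IsPullback f1 g1 j1 g2 →
          (p : Hom P K) → i1 ∘ₕ p ≈ₕ f1 →
          Σ[ u ∈ Hom Q' B ] ((j2 ∘ₕ u ≈ₕ g2) × (u ∘ₕ g1 ≈ₕ i2 ∘ₕ p) ×
            (∀ u' → j2 ∘ₕ u' ≈ₕ g2 → u' ∘ₕ g1 ≈ₕ i2 ∘ₕ p → u' ≈ₕ u))
  final P Q' f1 g1 g2 pb p i1p≈f1 =
    u , factor-commutes mj2 g2⊆j2 , ug1≈i2p , λ u' j2u'≈g2 _ → factor-unique mj2 g2⊆j2 u' j2u'≈g2
    where
    g2⊆j2 : g2 ⊆Im j2
    g2⊆j2 = Pushout.pullback-leg⊆Im {i1 = i1} {i2 = i2} {j1 = j1} {j2 = j2} po f1 g1 g2 pb p i1p≈f1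
    u = factor mj2 g2⊆j2
    ug1≈i2p : u ∘ₕ g1 ≈ₕ i2 ∘ₕ p
    ug1≈i2p = match-cancelˡ j2 mj2 (u ∘ₕ g1) (i2 ∘ₕ p) (begin
      j2 ∘ₕ u ∘ₕ g1  ≈⟨ ∘ₕ-congʳ (j2 ∘ₕ u) g2 (factor-commutes mj2 g2⊆j2) g1 ⟩
      g2 ∘ₕ g1       ≈⟨ proj₁ pb ⟨
      j1 ∘ₕ f1       ≈⟨ ∘ₕ-congˡ j1 (i1 ∘ₕ p) f1 i1p≈f1 ⟨
      j1 ∘ₕ i1 ∘ₕ p  ≈⟨ ∘ₕ-congʳ (j1 ∘ₕ i1) (j2 ∘ₕ i2) (proj₁ po) p ⟩
      j2 ∘ₕ i2 ∘ₕ p  ∎)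
      where open SetoidReasoning (Hom-setoid P Q)

pushout-retract : ∀ {K A B B' Q} (i1 : Hom K A) (i2 : Hom K B) (i2' : Hom K B')
                    (j1 : Hom A Q) (j2 : Hom B Q) (j2' : Hom B' Q) →
                  IsPushout i1 i2' j1 j2' → j1 ∘ₕ i1 ≈ₕ j2 ∘ₕ i2 →
                  (φ : Hom B' B) (ψ : Hom B B') →
                  φ ∘ₕ i2' ≈ₕ i2 → j2 ∘ₕ φ ≈ₕ j2' → j2' ∘ₕ ψ ≈ₕ j2 → φ ∘ₕ ψ ≈ₕ idₕ →
                  IsPushout i1 i2 j1 j2
pushout-retract {K} {A} {B} {B'} {Q} i1 i2 i2' j1 j2 j2' po' j1i1≈j2i2 φ ψ φi2'≈i2 j2φ≈j2' j2'ψ≈j2 φψ≈id =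
  j1i1≈j2i2 , mediate
  where
  mediate : ∀ T (a : Hom A T) (b : Hom B T) → a ∘ₕ i1 ≈ₕ b ∘ₕ i2 →
            Σ[ u ∈ Hom Q T ] ((u ∘ₕ j1 ≈ₕ a) × (u ∘ₕ j2 ≈ₕ b) ×
              (∀ u' → u' ∘ₕ j1 ≈ₕ a → u' ∘ₕ j2 ≈ₕ b → u' ≈ₕ u))
  mediate T a b ai1≈bi2 = u , uj1≈a , uj2≈b , unique
    where
    ai1≈bφi2' : a ∘ₕ i1 ≈ₕ (b ∘ₕ φ) ∘ₕ i2'
    ai1≈bφi2' = begin
      a ∘ₕ i1        ≈⟨ ai1≈bi2 ⟩
      b ∘ₕ i2        ≈⟨ ∘ₕ-congˡ b (φ ∘ₕ i2') i2 φi2'≈i2 ⟨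
      b ∘ₕ φ ∘ₕ i2'  ∎
      where open SetoidReasoning (Hom-setoid K T)
    U = proj₂ po' T a (b ∘ₕ φ) ai1≈bφi2'
    u = proj₁ U
    uj1≈a = proj₁ (proj₂ U)
    uj2'≈bφ = proj₁ (proj₂ (proj₂ U))
    uj2≈b : u ∘ₕ j2 ≈ₕ b
    uj2≈b = begin
      u ∘ₕ j2         ≈⟨ ∘ₕ-congˡ u (j2' ∘ₕ ψ) j2 j2'ψ≈j2 ⟨
      u ∘ₕ j2' ∘ₕ ψ   ≈⟨ ∘ₕ-congʳ (u ∘ₕ j2') (b ∘ₕ φ) uj2'≈bφ ψ ⟩
      b ∘ₕ φ ∘ₕ ψ     ≈⟨ ∘ₕ-congˡ b (φ ∘ₕ ψ) idₕ φψ≈id ⟩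
      b               ∎
      where open SetoidReasoning (Hom-setoid B T)
    unique : ∀ u' → u' ∘ₕ j1 ≈ₕ a → u' ∘ₕ j2 ≈ₕ b → u' ≈ₕ u
    unique u' u'j1≈a u'j2≈b = proj₂ (proj₂ (proj₂ U)) u' u'j1≈a (begin
      u' ∘ₕ j2'       ≈⟨ ∘ₕ-congˡ u' (j2 ∘ₕ φ) j2' j2φ≈j2' ⟨
      u' ∘ₕ j2 ∘ₕ φ   ≈⟨ ∘ₕ-congʳ (u' ∘ₕ j2) b u'j2≈b φ ⟩
      b ∘ₕ φ          ∎)
      where open SetoidReasoning (Hom-setoid B' T)

FPBC⇒pushout : ∀ {K A B B' Q} (i1 : Hom K A) (i2 : Hom K B) (i2' : Hom K B')
                 (j1 : Hom A Q) (j2 : Hom B Q) (j2' : Hom B' Q) →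
               IsFPBC i1 j1 i2 j2 → IsMatch j2 →
               IsPushout i1 i2' j1 j2' → IsMatch i1 → IsMatch j2' →
               IsPushout i1 i2 j1 j2
FPBC⇒pushout {K} {A} {B} {B'} {Q} i1 i2 i2' j1 j2 j2' (pb , final) mj2 po' mi1 mj2' =
  pushout-retract i1 i2 i2' j1 j2 j2' po' (proj₁ pb) φ ψ φi2'≈i2 j2φ≈j2' (factor-commutes mj2' j2⊆j2') φψ≈id
  where
  Φ = final K B' i1 i2' j2' (pushout⇒pullback i1 i2' j1 j2' po' mi1 mj2') idₕ (≈ₕ-refl i1)
  φ = proj₁ Φ
  j2φ≈j2' = proj₁ (proj₂ Φ)
  φi2'≈i2 = proj₁ (proj₂ (proj₂ Φ))
  j2⊆j2' : j2 ⊆Im j2'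
  j2⊆j2' = Pushout.pullback-leg⊆Im {i1 = i1} {i2 = i2'} {j1 = j1} {j2 = j2'} po' i1 i2 j2 pb idₕ (≈ₕ-refl i1)
  ψ = factor mj2' j2⊆j2'
  φψ≈id : φ ∘ₕ ψ ≈ₕ idₕ
  φψ≈id = match-cancelˡ j2 mj2 (φ ∘ₕ ψ) idₕ (begin
    j2 ∘ₕ φ ∘ₕ ψ  ≈⟨ ∘ₕ-congʳ (j2 ∘ₕ φ) j2' j2φ≈j2' ψ ⟩
    j2' ∘ₕ ψ      ≈⟨ factor-commutes mj2' j2⊆j2' ⟩
    j2            ∎)
    where open SetoidReasoning (Hom-setoid B Q)

lemma3 : ∀ {L R G H D : Graph} (α : Rule L R) (g : Hom R H) (f : Hom L G)
           (h : Hom (Rule.K α) D) (β1 : Hom D G) (β2 : Hom D H) →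
           IsMatch g →
           IsDerivation (α †) g f h β2 β1 →
           (Derivable α g ⇔ IsDerivation α f g h β1 β2)
lemma3 α g f h β1 β2 mg (_ , mh , fpbc† , po† , mf , mβ2 , mβ1) =
  mk⇔ reverse (λ derivation → _ , f , _ , h , β1 , β2 , derivation)
  where
  open Rule α
  reverse : Derivable α g → IsDerivation α f g h β1 β2
  reverse (_ , _ , _ , h' , _ , β2' , (_ , _ , _ , po , _ , _ , mβ2')) =
    mf , mh , pushout⇒FPBC α1 h f β1 po† α1-match mβ1 ,
    FPBC⇒pushout α2 h h' g β2 β2' fpbc† mβ2 po α2-match mβ2' , mg , mβ1 , mβ2
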